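{- Work in the theory $\mathsf{SB}$ described in the context, and let $\mathsf H$ be the formula defined there. Then $\mathsf{SB}$ proves that $\mathsf H$ is a function from $\mathsf A/\mathsf E_{\mathsf A}$ to $\mathsf B/\mathsf E_{\mathsf B}$: that is, $\mathsf{SB}$ proves (i) if $x\,\mathsf E_{\mathsf A}\,x'$, $y\,\mathsf E_{\mathsf B}\,y'$ and $x\mathrel{\mathsf H}y$, then $x'\mathrel{\mathsf H}y'$; (ii) if $x\mathrel{\mathsf H}y$ and $x\mathrel{\mathsf H}y'$, then $y\,\mathsf E_{\mathsf B}\,y'$; (iii) for every $x\in\mathsf A$ there is a $y$ with $x\mathrel{\mathsf H}y$.
   Context: The theory $\mathsf{ac}$ (adjunctive class theory) is two-sorted, with a sort of objects (variables $x,y,\dots$) and a sort of classes (variables $X,Y,\dots$), identity on each sort, and a membership relation $\in$ between objects and classes, with axioms: there is a class with no members; for every class $Y$ and object $y$ there is a class $X$ with $\forall x\,(x\in X\leftrightarrow (x\in Y\vee x=y))$; classes with the same members are equal. The theory $\mathsf{SB}$ is $\mathsf{ac}$ extended with unary predicates $\mathsf A,\mathsf B$ on objects and binary predicates $\mathsf E_{\mathsf A},\mathsf E_{\mathsf B},\mathsf F,\mathsf G$ on objects, with axioms stating: $\mathsf E_{\mathsf A}$ is an equivalence relation on $\{x\mid \mathsf A x\}$ (and holds only between elements of $\mathsf A$); $\mathsf E_{\mathsf B}$ is an equivalence relation on $\{y\mid\mathsf B y\}$; $\mathsf F$ is an injection from $\mathsf A/\mathsf E_{\mathsf A}$ to $\mathsf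 B/\mathsf E_{\mathsf B}$; $\mathsf G$ is an injection from $\mathsf B/\mathsf E_{\mathsf B}$ to $\mathsf A/\mathsf E_{\mathsf A}$. Here "$\mathsf F$ is an injection from $\mathsf A/\mathsf E_{\mathsf A}$ to $\mathsf B/\mathsf E_{\mathsf B}$" means: $x\mathrel{\mathsf F}y$ implies $\mathsf A x$ and $\mathsf B y$; if $x\,\mathsf E_{\mathsf A}\,x'\mathrel{\mathsf F}y'\,\mathsf E_{\mathsf B}\,y$ then $x\mathrel{\mathsf F}y$; every $x\in\mathsf A$ has some $y$ with $x\mathrel{\mathsf F}y$; $x\mathrel{\mathsf F}y$ and $x\mathrel{\mathsf F}y'$ imply $y\,\mathsf E_{\mathsf B}\,y'$; $x\mathrel{\mathsf F}y$ and $x'\mathrel{\mathsf F}y$ imply $x\,\mathsf E_{\mathsf A}\,x'$. Similarly for $\mathsf G$ with the roles of $\mathsf A,\mathsf B$ swapped. A pair of classes $(X,Y)$ is downwards closed if $X\subseteq\mathsf A$, $Y\subseteq \mathsf B$, whenever $v\mathrel{\mathsf G}u$ and $u\in X$ there is $v'\in Y$ with $v'\mathrel{\mathsf G}u$, and whenever $u\mathrel{\mathsf F}v$ and $v\in Y$ there is $u'\in X$ with $u'\mathrel{\mathsf F}v$. $(X,Y)$ is an $x$-switch if it is downwards closed, $x\in X$, and every member of $X$ is in the range of $\mathsf G$. Define $x\mathrel{\mathsf H}y$ iff (there is no $x$-switch and $x\mathrel{\mathsf F}y$) or (there is an $x$-switch and $y\mathrel{\mathsf G}x$). -}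

module Defs where

open import Data.Product using (Σ; ∃; ∃-syntax; _×_; _,_)
open import Data.Sum using (_⊎_)
open import Data.Empty using (⊥)
open import Relation.Nullary using (¬_)
open import Relation.Binary.PropositionalEquality using (_≡_)

-- A (set-)model of the two-sorted theory SB.
-- Objects and classes are the two sorts; identity on each sort is _≡_.
record SB : Set₁ where
  field
    Obj : Set
    Cls : Set
    _∈_ : Obj → Cls → Set
    empty       : ∃[ X ] (∀ x → ¬ (x ∈ X))
    adjunction  : ∀ (Y : Cls) (y : Obj) →
                  ∃[ X ] (∀ x → (x ∈ X → (x ∈ Y ⊎ x ≡ y)) × ((x ∈ Y ⊎ x ≡ y) → x ∈ X))
    extensional : ∀ (X Y : Cls) → (∀ x → (x ∈ X → x ∈ Y) × (x ∈ Y → x ∈ X)) → X ≡ Y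
    A B : Obj → Set
    EA EB F G : Obj → Obj → Set
    EA-dom   : ∀ {x y} → EA x y → A x × A y
    EA-refl  : ∀ {x} → A x → EA x x
    EA-sym   : ∀ {x y} → EA x y → EA y x
    EA-trans : ∀ {x y z} → EA x y → EA y z → EA x z
    EB-dom   : ∀ {x y} → EB x y → B x × B y
    EB-refl  : ∀ {x} → B x → EB x x
    EB-sym   : ∀ {x y} → EB x y → EB y x
    EB-trans : ∀ {x y z} → EB x y → EB y z → EB x z
    F-dom   : ∀ {x y} → F x y → A x × B y
    F-resp  : ∀ {x x' y' y} → EA x x' → F x' y' → EB y' y → F x y
    F-total : ∀ {x} → A x → ∃[ y ] F x y
    F-func  : ∀ {x y y'} → F x y → F x y' → EB y y'
    F-inj   : ∀ {x x' y} → F x y → F x' y → EA x x'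
    G-dom   : ∀ {x y} → G x y → B x × A y
    G-resp  : ∀ {x x' y' y} → EB x x' → G x' y' → EA y' y → G x y
    G-total : ∀ {x} → B x → ∃[ y ] G x y
    G-func  : ∀ {x y y'} → G x y → G x y' → EA y y'
    G-inj   : ∀ {x x' y} → G x y → G x' y → EB x x'

module _ (M : SB) where
  open SB M

  DownwardsClosed : Cls → Cls → Set
  DownwardsClosed X Y =
      (∀ u → u ∈ X → A u)
    × (∀ v → v ∈ Y → B v)
    × (∀ v u → G v u → u ∈ X → ∃[ v' ] (v' ∈ Y × G v' u))
    × (∀ u v → F u v → v ∈ Y → ∃[ u' ] (u' ∈ X × F u' v))

  Switch : Obj → Cls → Cls → Set
  Switch x X Y =
      DownwardsClosed X Y
    × x ∈ X
    × (∀ u → u ∈ X → ∃[ v ] G v u)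

  HasSwitch : Obj → Set
  HasSwitch x = ∃[ X ] ∃[ Y ] Switch x X Y

  H : Obj → Obj → Set
  H x y = (¬ HasSwitch x × F x y) ⊎ (HasSwitch x × G y x)

{-# OPTIONS --safe #-}
-- Adjoining x' to an x-switch gives an x'-switch whenever x E_A x', so having a switch is
-- invariant on E_A-classes. On each class H is therefore either F or the converse of G, both
-- of which are injective functions between the quotients; excluded middle decides which one
-- applies, and that is all totality needs.
module Submission where

open import Defs
open import Data.Product using (∃-syntax; _×_; _,_; proj₁; proj₂; map₁; map₂)
open import Data.Sum using (_⊎_; inj₁; inj₂)
open import Data.Empty using (⊥-elim)
open import Function using (_∘_)
open import Relation.Nullary using (yes; no)
open import Relation.Binary.PropositionalEquality using (_≡_; refl)
open import Axiom.ExcludedMiddle using (ExcludedMiddle)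
open import Level using (0ℓ)

module _ (M : SB) where
  open SB M

  G-respʳ : ∀ {v u u'} → G v u → EA u u' → G v u'
  G-respʳ g u≈u' = G-resp (EB-refl (proj₁ (G-dom g))) g u≈u'

  insert : Cls → Obj → Cls
  insert X y = proj₁ (adjunction X y)

  ∈-insert⁻ : ∀ {X y x} → x ∈ insert X y → x ∈ X ⊎ x ≡ y
  ∈-insert⁻ {X} {y} {x} = proj₁ (proj₂ (adjunction X y) x)

  ∈-insert⁺ : ∀ {X y x} → x ∈ X ⊎ x ≡ y → x ∈ insert X y
  ∈-insert⁺ {X} {y} {x} = proj₂ (proj₂ (adjunction X y) x)

  Switch-resp : ∀ {x x' X Y} → EA x x' → Switch M x X Y → Switch M x' (insert X x') Y
  Switch-resp {x} {x'} {X} {Y} x≈x' ((X⊆A , Y⊆B , closedG , closedF) , x∈X , X⊆ranG) =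
    (X'⊆A , Y⊆B , closedG' , closedF') , ∈-insert⁺ (inj₂ refl) , X'⊆ranG
    where
    X'⊆A : ∀ u → u ∈ insert X x' → A u
    X'⊆A u u∈X' with ∈-insert⁻ u∈X'
    ... | inj₁ u∈X = X⊆A u u∈X
    ... | inj₂ refl = proj₂ (EA-dom x≈x')

    closedG' : ∀ v u → G v u → u ∈ insert X x' → ∃[ v' ] (v' ∈ Y × G v' u)
    closedG' v u g u∈X' with ∈-insert⁻ u∈X'
    ... | inj₁ u∈X = closedG v u g u∈X
    ... | inj₂ refl =
      map₂ (map₂ (λ g' → G-respʳ g' x≈x')) (closedG v x (G-respʳ g (EA-sym x≈x')) x∈X)

    closedF' : ∀ u v → F u v → v ∈ Y → ∃[ u' ] (u' ∈ insert X x' × F u' v)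
    closedF' u v f v∈Y = map₂ (map₁ (∈-insert⁺ ∘ inj₁)) (closedF u v f v∈Y)

    X'⊆ranG : ∀ u → u ∈ insert X x' → ∃[ v ] G v u
    X'⊆ranG u u∈X' with ∈-insert⁻ u∈X'
    ... | inj₁ u∈X = X⊆ranG u u∈X
    ... | inj₂ refl = map₂ (λ g → G-respʳ g x≈x') (X⊆ranG x x∈X)

  HasSwitch-resp : ∀ {x x'} → EA x x' → HasSwitch M x → HasSwitch M x'
  HasSwitch-resp x≈x' (X , Y , s) = insert X _ , Y , Switch-resp x≈x' s

  H-resp : ∀ {x x' y y'} → EA x x' → EB y y' → H M x y → H M x' y'
  H-resp x≈x' y≈y' (inj₁ (¬s , f)) =
    inj₁ (¬s ∘ HasSwitch-resp (EA-sym x≈x') , F-resp (EA-sym x≈x') f y≈y')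
  H-resp x≈x' y≈y' (inj₂ (s , g)) =
    inj₂ (HasSwitch-resp x≈x' s , G-resp (EB-sym y≈y') g x≈x')

  H-func : ∀ {x y y'} → H M x y → H M x y' → EB y y'
  H-func (inj₁ (_ , f)) (inj₁ (_ , f')) = F-func f f'
  H-func (inj₁ (¬s , _)) (inj₂ (s , _)) = ⊥-elim (¬s s)
  H-func (inj₂ (s , _)) (inj₁ (¬s , _)) = ⊥-elim (¬s s)
  H-func (inj₂ (_ , g)) (inj₂ (_ , g')) = G-inj g g'

  H-total : ExcludedMiddle 0ℓ → ∀ {x} → A x → ∃[ y ] H M x y
  H-total em {x} x∈A with em {HasSwitch M x}
  ... | yes s@(X , Y , _ , x∈X , X⊆ranG) = map₂ (λ g → inj₂ (s , g)) (X⊆ranG x x∈X)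
  ... | no ¬s = map₂ (λ f → inj₁ (¬s , f)) (F-total x∈A)

lemma4p1 : ExcludedMiddle 0ℓ → (M : SB) →
    ((∀ {x x' y y'} → SB.EA M x x' → SB.EB M y y' → H M x y → H M x' y')
    × (∀ {x y y'} → H M x y → H M x y' → SB.EB M y y')
    × (∀ {x} → SB.A M x → ∃[ y ] H M x y))
lemma4p1 em M = H-resp M , H-func M , H-total M em
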